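{- Let $\mathcal{N}=(P,T,F,m_{init})$ be a Petri net and let $Z\subseteq P$ be the maximal (for inclusion) set of places such that $I_Z=\{m\in\mathbb{N}^P\mid \bigwedge_{p\in Z} m(p)=0\}$ is an inductive invariant of $\mathcal{N}$. Define $Q_0=\{q\in P\mid m_{init}(q)>0\}$, $Q_{k+1}=Q_k\cup\bigcup_{t\in T}\operatorname{prop}_t(Q_k)$, and $Q=\bigcup_{k\ge 0}Q_k$. Then $Z=P\setminus Q$.
   Context: A Petri net is a tuple $\mathcal{N}=(P,T,F,m_{init})$ with finite disjoint sets $P$ (places) and $T$ (transitions), a flow function $F:(P\times T)\cup(T\times P)\to\mathbb{N}$, and an initial marking $m_{init}\in\mathbb{N}^P$. For $t\in T$, $m\xrightarrow{t}m'$ iff for all $p\in P$: $m(p)\ge F(p,t)$ and $m'(p)=m(p)-F(p,t)+F(t,p)$; $\xrightarrow{*}$ is the reflexive-transitive closure of the union of these relations. A set $I\subseteq\mathbb{N}^P$ is an invariant if it contains every $m$ with $m_{init}\xrightarrow{*}m$; it is an inductive invariant if moreover $m\in I$ and $m\xrightarrow{t}m'$ imply $m'\in I$. (The family of sets $Z$ for which $I_Z$ is an inductive invariant is closed under union, so the maximal such $Z$ exists.) For $t\in T$ and $Q\subseteq P$, define $\operatorname{prop}_t(Q)=\{q\in P\mid F(t,q)>0\}$ if $F(p,t)=0$ for all $p\in P\setminus Q$, and $\operatorname{prop}_t(Q)=\emptyset$ otherwise. -}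

module Defs where

open import Data.Nat using (ℕ; zero; suc; _+_; _∸_; _≤_; _<_)
open import Data.Fin using (Fin)
open import Data.Product using (Σ; _×_; ∃; ∃-syntax)
open import Data.Sum using (_⊎_)
open import Relation.Nullary using (¬_)
open import Relation.Binary.PropositionalEquality using (_≡_)
open import Relation.Unary using (Pred; _⊆_; _∈_; _∉_)
open import Level using (0ℓ)

record PetriNet (np nt : ℕ) : Set where
  field
    pre   : Fin np → Fin nt → ℕ   -- F(p,t)
    post  : Fin nt → Fin np → ℕ   -- F(t,p)
    minit : Fin np → ℕ

Marking : ℕ → Set
Marking np = Fin np → ℕ

PlaceSet : ℕ → Set₁
PlaceSet np = Pred (Fin np) 0ℓ

module _ {np nt : ℕ} (N : PetriNet np nt) where
  open PetriNet N

  Step : Marking np → Fin nt → Marking np → Set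
  Step m t m' = ∀ p → (pre p t ≤ m p) × (m' p ≡ (m p ∸ pre p t) + post t p)

  data Reach : Marking np → Marking np → Set where
    reach-refl : ∀ {m} → Reach m m
    reach-step : ∀ {m m' m''} (t : Fin nt) → Step m t m' → Reach m' m'' → Reach m m''

  Invariant : Pred (Marking np) 0ℓ → Set
  Invariant I = ∀ m → Reach minit m → I m

  InductiveInvariant : Pred (Marking np) 0ℓ → Set
  InductiveInvariant I =
    Invariant I × (∀ m t m' → I m → Step m t m' → I m')

  IZ : PlaceSet np → Pred (Marking np) 0ℓ
  IZ Z m = ∀ p → p ∈ Z → m p ≡ 0

  IsMaximalZ : PlaceSet np → Set₁
  IsMaximalZ Z = InductiveInvariant (IZ Z)
               × (∀ (Z' : PlaceSet np) → InductiveInvariant (IZ Z') → Z' ⊆ Z)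

  prop : Fin nt → PlaceSet np → PlaceSet np
  prop t Q q = (∀ p → p ∉ Q → pre p t ≡ 0) × (0 < post t q)

  Qk : ℕ → PlaceSet np
  Qk zero q = 0 < minit q
  Qk (suc k) q = Qk k q ⊎ (∃[ t ] q ∈ prop t (Qk k))

  Qinf : PlaceSet np
  Qinf q = ∃[ k ] q ∈ Qk k

-- Qinf avoids every Z with I_Z inductive: a transition t can always fire from
-- the marking "exactly its preset", which lies in I_Z once the preset lies in
-- Q_k, and then it marks everything in prop_t(Q_k).  Conversely the complement
-- of Qinf is such a Z: if t is enabled at a marking vanishing outside Qinf, its
-- preset lies in Qinf, hence (being finite) in a single Q_K, so everything t
-- produces lies in Q_{K+1}.  Constructively "lies in Qinf" is only obtained
-- doubly negated here, which suffices because the goal is an equation in ℕ.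
module Submission where

open import Defs
open import Data.Nat using (ℕ; zero; suc; _+_; _∸_; _≤_; _≤′_; ≤′-reflexive; ≤′-step; _⊔_; _≟_)
open import Data.Nat.Properties
  using (≤-refl; n∸n≡0; 0∸n≡0; n≤0⇒n≡0; n≢0⇒n>0; n>0⇒n≢0; m≤m⊔n; m≤n⊔m; ≤⇒≤′)
open import Data.Fin using (Fin)
import Data.Fin as Fin
open import Data.Product using (_×_; _,_; proj₁; proj₂; ∃-syntax)
open import Data.Sum using (_⊎_; inj₁; inj₂; [_,_])
open import Function using (_∘_; id)
open import Level using (0ℓ)
open import Relation.Nullary using (¬_; yes; no; contradiction)
open import Relation.Nullary.Decidable using (decidable-stable)
open import Relation.Nullary.Negation using (¬¬-Monad)
open import Relation.Unary using (Pred; _⊆_; _∈_; _∉_; ∁)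
open import Relation.Binary.PropositionalEquality using (_≡_; refl; sym; cong; cong₂; subst; module ≡-Reasoning)
open import Effect.Monad using (RawMonad)

¬¬-uniformBound : ∀ {n} {A : Pred (Fin n) 0ℓ} (P : ℕ → Pred (Fin n) 0ℓ) →
  (∀ {k l} → k ≤ l → P k ⊆ P l) →
  (∀ i → ¬ ¬ (A i ⊎ ∃[ k ] P k i)) →
  ¬ ¬ (∃[ K ] ∀ i → A i ⊎ P K i)
¬¬-uniformBound {zero} P mono h = contradiction (0 , λ ())
¬¬-uniformBound {suc n} {A} P mono h = do
  head ← h Fin.zero
  (K , tail) ← ¬¬-uniformBound (λ k → P k ∘ Fin.suc) (λ k≤l → mono k≤l) (h ∘ Fin.suc)
  return (combine head K tail)
  where
  open RawMonad ¬¬-Monad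

  raise : ∀ {k l i} → k ≤ l → A i ⊎ P k i → A i ⊎ P l i
  raise k≤l = [ inj₁ , inj₂ ∘ mono k≤l ]

  combine : A Fin.zero ⊎ ∃[ k ] P k Fin.zero → ∀ K → (∀ i → A (Fin.suc i) ⊎ P K (Fin.suc i)) →
            ∃[ K′ ] ∀ i → A i ⊎ P K′ i
  combine (inj₁ a) K tail = K , λ { Fin.zero → inj₁ a ; (Fin.suc i) → tail i }
  combine (inj₂ (k , p)) K tail =
    k ⊔ K , λ { Fin.zero → inj₂ (mono (m≤m⊔n k K) p)
              ; (Fin.suc i) → raise (m≤n⊔m k K) (tail i) }

module _ {np nt : ℕ} (N : PetriNet np nt) where
  open PetriNet N

  reach-preserves : ∀ {I : Pred (Marking np) 0ℓ} →
    (∀ m t m′ → I m → Step N m t m′ → I m′) →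
    ∀ {m m′} → I m → Reach N m m′ → I m′
  reach-preserves closed m∈I reach-refl = m∈I
  reach-preserves closed m∈I (reach-step t st r) =
    reach-preserves closed (closed _ t _ m∈I st) r

  step-from-preset : ∀ t → Step N (λ p → pre p t) t (post t)
  step-from-preset t p = ≤-refl , cong (_+ post t p) (sym (n∸n≡0 (pre p t)))

  Qk-mono : ∀ {k l} → k ≤ l → Qk N k ⊆ Qk N l
  Qk-mono = mono′ ∘ ≤⇒≤′
    where
    mono′ : ∀ {k l} → k ≤′ l → Qk N k ⊆ Qk N l
    mono′ (≤′-reflexive refl) = id
    mono′ (≤′-step k≤′l)      = inj₁ ∘ mono′ k≤′l

  Qk-avoids : ∀ {Z} → InductiveInvariant N (IZ N Z) → ∀ k {q} → q ∈ Qk N k → q ∉ Z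
  Qk-avoids (invariant , _) zero q∈Q₀ q∈Z =
    n>0⇒n≢0 q∈Q₀ (invariant minit reach-refl _ q∈Z)
  Qk-avoids ZInd (suc k) (inj₁ q∈Q) = Qk-avoids ZInd k q∈Q
  Qk-avoids {Z} ZInd@(_ , closed) (suc k) (inj₂ (t , presetInQ , produces)) q∈Z =
    n>0⇒n≢0 produces (closed _ t _ preset∈IZ (step-from-preset t) _ q∈Z)
    where
    preset∈IZ : (λ p → pre p t) ∈ IZ N Z
    preset∈IZ p p∈Z = decidable-stable (pre p t ≟ 0)
      (λ pre≢0 → pre≢0 (presetInQ p (λ p∈Q → Qk-avoids ZInd k p∈Q p∈Z)))

  preset-∈-Qinf : ∀ {m t m′} → m ∈ IZ N (∁ (Qinf N)) → Step N m t m′ →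
                  ∀ p → ¬ ¬ (pre p t ≡ 0 ⊎ p ∈ Qinf N)
  preset-∈-Qinf {t = t} m∈IZ step p with pre p t ≟ 0
  ... | yes pre≡0 = λ ¬goal → ¬goal (inj₁ pre≡0)
  ... | no pre≢0 = λ ¬goal → pre≢0 (n≤0⇒n≡0
        (subst (pre p t ≤_) (m∈IZ p (¬goal ∘ inj₂)) (proj₁ (step p))))

  post-∉-Qinf : ∀ {m t m′} → m ∈ IZ N (∁ (Qinf N)) → Step N m t m′ →
                ∀ {q} → q ∉ Qinf N → post t q ≡ 0
  post-∉-Qinf {t = t} m∈IZ step {q} q∉Q = decidable-stable (post t q ≟ 0) λ post≢0 →
    ¬¬-uniformBound (Qk N) Qk-mono (preset-∈-Qinf m∈IZ step)
      λ { (K , presetInQ) → q∉Q (suc K , inj₂ (t , pre-vanishes presetInQ , n≢0⇒n>0 post≢0)) }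
    where
    pre-vanishes : ∀ {K} → (∀ p → pre p t ≡ 0 ⊎ p ∈ Qk N K) → ∀ p → p ∉ Qk N K → pre p t ≡ 0
    pre-vanishes presetInQ p p∉Q = [ id , (λ p∈Q → contradiction p∈Q p∉Q) ] (presetInQ p)

  IZ-∁Qinf-closed : ∀ m t m′ → m ∈ IZ N (∁ (Qinf N)) → Step N m t m′ → m′ ∈ IZ N (∁ (Qinf N))
  IZ-∁Qinf-closed m t m′ m∈IZ step q q∉Q = begin
    m′ q                       ≡⟨ proj₂ (step q) ⟩
    (m q ∸ pre q t) + post t q ≡⟨ cong₂ (λ x y → (x ∸ pre q t) + y) (m∈IZ q q∉Q) (post-∉-Qinf m∈IZ step q∉Q) ⟩
    (0 ∸ pre q t) + 0          ≡⟨ cong (_+ 0) (0∸n≡0 (pre q t)) ⟩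
    0                          ∎
    where open ≡-Reasoning

  IZ-∁Qinf-inductive : InductiveInvariant N (IZ N (∁ (Qinf N)))
  IZ-∁Qinf-inductive =
    (λ _ → reach-preserves IZ-∁Qinf-closed minit∈IZ) , IZ-∁Qinf-closed
    where
    minit∈IZ : minit ∈ IZ N (∁ (Qinf N))
    minit∈IZ q q∉Q = decidable-stable (minit q ≟ 0) (λ minit≢0 → q∉Q (0 , n≢0⇒n>0 minit≢0))

mainTheorem3 : ∀ {np nt : ℕ} (N : PetriNet np nt) (Z : PlaceSet np) →
    IsMaximalZ N Z →
    (∀ (p : Fin np) → p ∈ Z → p ∉ Qinf N) × (∀ (p : Fin np) → p ∉ Qinf N → p ∈ Z)
mainTheorem3 N Z (ZInd , maximal) =
  (λ p p∈Z (k , p∈Qk) → Qk-avoids N ZInd k p∈Qk p∈Z) ,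
  (λ p → maximal (∁ (Qinf N)) (IZ-∁Qinf-inductive N))
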